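{- Let $t$ be a term and $\vec{x}=(x_1,\dots,x_k)$ a list of pairwise distinct variables with $\mathrm{Fv}(t)\subseteq\{x_1,\dots,x_k\}$. The following are equivalent: (1) $t$ is $\rhd\mathsf{shuf}$-normalizable and its $\rhd\mathsf{shuf}$-normal form is a value; (2) $((\mathbf{0},\dots,\mathbf{0}),\mathbf{0}) \in [\![t]\!]_{\vec{x}}$ (with $k$ copies of $\mathbf{0}$ in the tuple); (3) there exists a derivation with conclusion $\vdash t\colon\mathbf{0}$ (empty environment).
   Context: Terms: $t ::= x \mid \lambda x.t \mid tu$ (up to $\alpha$); values $v ::= x \mid \lambda x.t$; $\mathrm{Fv}(t)$ free variables; $t\{v/x\}$ substitution. Root steps: ($\beta_v$) $(\lambda x.t)v \mapsto t\{v/x\}$, $v$ a value; ($\sigma_1$) $(\lambda x.t)us \mapsto (\lambda x.ts)u$ if $x\notin\mathrm{Fv}(s)$; ($\sigma_3$) $v((\lambda x.s)u)\mapsto(\lambda x.vs)u$ if $v$ a value, $x\notin\mathrm{Fv}(v)$. Balanced contexts $B ::= [\cdot] \mid (\lambda x.B)t \mid Bt \mid tB$; $\rhd r$-reduction is the closure of root step $r$ under balanced contexts; $\rhd\mathsf{shuf}$ is the union of $\rhd\beta_v,\rhd\sigma_1,\rhd\sigma_3$. Types: positive types are finite multisets $[(P_1,Q_1),\dots,(P_n,Q_n)]$ of pairs of positive types ($\mathbf{0}$ empty, $\uplus$ union). Environments map variables to positive types (finitely many non-$\mathbf{0}$), combined pointwise by $\uplus$. Rules: (ax) $x\colon P\vdash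 x\colon P$; ($\lambda$) from $\Gamma_i,x\colon P_i\vdash t\colon Q_i$ ($1\le i\le n$, $n\ge0$) infer $\biguplus_i\Gamma_i\vdash\lambda x.t\colon[(P_1,Q_1),\dots,(P_n,Q_n)]$; ($@$) from $\Gamma\vdash t\colon[(P,Q)]$ and $\Delta\vdash u\colon P$ infer $\Gamma\uplus\Delta\vdash tu\colon Q$. Relational semantics: $[\![t]\!]_{\vec{x}}=\{((P_1,\dots,P_k),Q)\mid x_1\colon P_1,\dots,x_k\colon P_k\vdash t\colon Q\text{ derivable}\}$. -}

module Defs where

open import Data.Nat using (ℕ; zero; suc)
open import Data.Fin using (Fin; zero; suc)
open import Data.List using (List; []; _∷_; _++_)
open import Data.Vec using (Vec; []; _∷_; replicate; zipWith; _[_]≔_)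
open import Data.Vec.Relation.Binary.Pointwise.Inductive using (Pointwise)
open import Data.Product using (_×_; _,_; proj₁; proj₂; ∃-syntax)
open import Relation.Nullary using (¬_)
open import Relation.Binary.Construct.Closure.ReflexiveTransitive using (Star)

-- Terms (well-scoped de Bruijn; α-equivalence is syntactic identity).
-- A term `Term k` is a term whose free variables lie among k fixed,
-- pairwise distinct variables x₁ … xₖ (represented by Fin k).

data Term (n : ℕ) : Set where
  var : Fin n → Term n
  lam : Term (suc n) → Term n
  app : Term n → Term n → Term n

data Value {n : ℕ} : Term n → Set where
  var : (x : Fin n) → Value (var x)
  lam : (t : Term (suc n)) → Value (lam t)

ext : {m n : ℕ} → (Fin m → Fin n) → Fin (suc m) → Fin (suc n)
ext ρ zero    = zero
ext ρ (suc i) = suc (ρ i)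

rename : {m n : ℕ} → (Fin m → Fin n) → Term m → Term n
rename ρ (var x)   = var (ρ x)
rename ρ (lam t)   = lam (rename (ext ρ) t)
rename ρ (app t u) = app (rename ρ t) (rename ρ u)

weaken : {n : ℕ} → Term n → Term (suc n)
weaken = rename suc

exts : {m n : ℕ} → (Fin m → Term n) → Fin (suc m) → Term (suc n)
exts σ zero    = var zero
exts σ (suc i) = weaken (σ i)

subst : {m n : ℕ} → (Fin m → Term n) → Term m → Term n
subst σ (var x)   = σ x
subst σ (lam t)   = lam (subst (exts σ) t)
subst σ (app t u) = app (subst σ t) (subst σ u)

single : {n : ℕ} → Term n → Fin (suc n) → Term n
single v zero    = v
single v (suc i) = var i

_[_]₀ : {n : ℕ} → Term (suc n) → Term n → Term n
t [ v ]₀ = subst (single v) t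

data RootβV {n : ℕ} : Term n → Term n → Set where
  βv : (t : Term (suc n)) (v : Term n) → Value v →
       RootβV (app (lam t) v) (t [ v ]₀)

-- (σ1): (λx.t)u s ↦ (λx.ts)u, x ∉ Fv(s) (expressed by weakening s)
data Rootσ1 {n : ℕ} : Term n → Term n → Set where
  σ1 : (t : Term (suc n)) (u s : Term n) →
       Rootσ1 (app (app (lam t) u) s) (app (lam (app t (weaken s))) u)

-- (σ3): v((λx.s)u) ↦ (λx.vs)u, v value, x ∉ Fv(v)
data Rootσ3 {n : ℕ} : Term n → Term n → Set where
  σ3 : (v : Term n) (s : Term (suc n)) (u : Term n) → Value v →
       Rootσ3 (app v (app (lam s) u)) (app (lam (app (weaken v) s)) u)

data RootShuf {n : ℕ} (t t' : Term n) : Set where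
  βv : RootβV t t' → RootShuf t t'
  σ1 : Rootσ1 t t' → RootShuf t t'
  σ3 : Rootσ3 t t' → RootShuf t t'

data Balanced (R : {n : ℕ} → Term n → Term n → Set) : {n : ℕ} → Term n → Term n → Set where
  root : {n : ℕ} {t t' : Term n} → R t t' → Balanced R t t'
  redex : {n : ℕ} {t t' : Term (suc n)} (u : Term n) →
          Balanced R t t' → Balanced R (app (lam t) u) (app (lam t') u)
  appL : {n : ℕ} {t t' : Term n} (u : Term n) →
         Balanced R t t' → Balanced R (app t u) (app t' u)
  appR : {n : ℕ} {u u' : Term n} (t : Term n) →
         Balanced R u u' → Balanced R (app t u) (app t u')

_▷shuf_ : {n : ℕ} → Term n → Term n → Set
t ▷shuf t' = Balanced RootShuf t t'

_▷shuf*_ : {n : ℕ} → Term n → Term n → Set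
_▷shuf*_ = Star _▷shuf_

ShufNormal : {n : ℕ} → Term n → Set
ShufNormal t = ∀ t' → ¬ (t ▷shuf t')

NormalizesToValue : {n : ℕ} → Term n → Set
NormalizesToValue t = ∃[ u ] (t ▷shuf* u × ShufNormal u × Value u)

-- Positive types: finite multisets of pairs of positive types.
-- Multisets are lists, considered up to (deep) bag equality _≈_.

data Pos : Set where
  ⟨_⟩ : List (Pos × Pos) → Pos

𝟘 : Pos
𝟘 = ⟨ [] ⟩

_⊎ₚ_ : Pos → Pos → Pos
⟨ xs ⟩ ⊎ₚ ⟨ ys ⟩ = ⟨ xs ++ ys ⟩

data _≈_ : Pos → Pos → Set
data _≋_ : List (Pos × Pos) → List (Pos × Pos) → Set

data _≈_ where
  ⟨_⟩ : {xs ys : List (Pos × Pos)} → xs ≋ ys → ⟨ xs ⟩ ≈ ⟨ ys ⟩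

data _≋_ where
  [] : [] ≋ []
  cons : {a b : Pos × Pos} {xs ys zs : List (Pos × Pos)} →
         proj₁ a ≈ proj₁ b → proj₂ a ≈ proj₂ b → xs ≋ (ys ++ zs) →
         (a ∷ xs) ≋ (ys ++ (b ∷ zs))

-- Environments on the k variables in scope (all others are 𝟘)
Env : ℕ → Set
Env n = Vec Pos n

∅ : {n : ℕ} → Env n
∅ {n} = replicate n 𝟘

_⊎ₑ_ : {n : ℕ} → Env n → Env n → Env n
_⊎ₑ_ = zipWith _⊎ₚ_

_≈ₑ_ : {n : ℕ} → Env n → Env n → Set
_≈ₑ_ = Pointwise _≈_

_↦ₑ_ : {n : ℕ} → Fin n → Pos → Env n
x ↦ₑ P = ∅ [ x ]≔ P

-- Typing derivations. Each rule's conclusion is taken up to multiset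
-- equality of the environment/type, as types are multisets.

data _⊢_∶_ {n : ℕ} : Env n → Term n → Pos → Set
data Premises {n : ℕ} (t : Term (suc n)) : Env n → List (Pos × Pos) → Set

data _⊢_∶_ {n} where
  ax  : {Γ : Env n} {x : Fin n} {P : Pos} →
        Γ ≈ₑ (x ↦ₑ P) → Γ ⊢ var x ∶ P
  lam : {Γ Γ' : Env n} {t : Term (suc n)} {ps : List (Pos × Pos)} {R : Pos} →
        Premises t Γ ps → Γ' ≈ₑ Γ → R ≈ ⟨ ps ⟩ → Γ' ⊢ lam t ∶ R
  app : {Γ Δ Θ : Env n} {t u : Term n} {P Q : Pos} →
        Γ ⊢ t ∶ ⟨ (P , Q) ∷ [] ⟩ → Δ ⊢ u ∶ P → Θ ≈ₑ (Γ ⊎ₑ Δ) → Θ ⊢ app t u ∶ Q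

-- the n ≥ 0 premises Γᵢ, x : Pᵢ ⊢ t : Qᵢ of the (λ) rule
data Premises {n} t where
  [] : Premises t ∅ []
  _∷_ : {Γ Δ : Env n} {P Q : Pos} {ps : List (Pos × Pos)} →
        (P ∷ Γ) ⊢ t ∶ Q → Premises t Δ ps → Premises t (Γ ⊎ₑ Δ) ((P , Q) ∷ ps)

⟦_⟧ : {k : ℕ} → Term k → Vec Pos k × Pos → Set
⟦ t ⟧ (Ps , Q) = Ps ⊢ t ∶ Q

-- Values are typed by 𝟘 in the empty environment, and typing is invariant under
-- ▷shuf-expansion; this gives (1) ⇒ (2). Conversely, typing is also invariant under
-- ▷shuf-reduction, and the number of (@) rules in the derivation together with a
-- multiplicative weight of the term decreases lexicographically: a βv-step consumes
-- one (@) rule (the multiset type of a value splits its derivation among the copies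
-- of the substituted variable instead of duplicating it), while σ-steps keep the
-- derivation and lower the weight. So every typable term normalizes, and a normal
-- form typable in the empty environment is a value, because a stuck application
-- would need a variable of arrow type. Finally (2) and (3) hold by definition.

module Submission where

open import Defs
open import Algebra.Bundles using (CommutativeMonoid)
import Algebra.Properties.CommutativeSemigroup as CommSemigroupProperties
open import Data.Empty using (⊥-elim)
open import Data.Fin using (Fin; zero; suc; punchIn)
open import Data.Fin.Properties using (punchInᵢ≢i)
open import Data.List using (List; []; _∷_; _++_)
open import Data.List.Properties using (++-assoc; ++-identityʳ)
open import Data.Maybe using (Maybe; just; nothing; maybe)
import Data.Maybe as Maybe
open import Data.Nat using (ℕ; zero; suc; _+_; _*_; _<_; _≤_; z≤n; s≤s; NonZero; >-nonZero)
open import Data.Nat.Induction using (<-wellFounded)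
import Data.Nat.Properties as ℕ
open import Data.Nat.Tactic.RingSolver using (solve-∀)
open import Data.Product using (_×_; _,_; proj₁; Σ-syntax; ∃-syntax)
open import Data.Product.Relation.Binary.Lex.Strict using (×-Lex; ×-wellFounded)
open import Data.Sum using (_⊎_; inj₁; inj₂)
open import Data.Unit using (⊤; tt)
open import Data.Vec using ([]; _∷_; replicate; lookup; insertAt; removeAt)
open import Data.Vec.Properties
  using (removeAt-insertAt; lookup∘update; lookup∘update′; ∷-injective; lookup-zipWith; lookup-replicate;
         zipWith-assoc; zipWith-identityˡ; zipWith-identityʳ)
open import Data.Vec.Relation.Binary.Pointwise.Inductive as Pointwise using ([]; _∷_)
open import Function using (_∘_; id)
open import Function.Bundles using (_⇔_; mk⇔)
open import Induction.WellFounded using (Acc; acc; WellFounded)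
open import Relation.Binary.Construct.Closure.ReflexiveTransitive using (ε; _◅_)
open import Relation.Binary.PropositionalEquality
  using (_≡_; refl; sym; trans; cong; cong₂; subst₂; _≗_) renaming (subst to ≡-subst)
import Relation.Binary.Reasoning.Setoid as SetoidReasoning
open import Relation.Nullary using (¬_)

infix 4 _≈²_ _≋′_

_≈²_ : Pos × Pos → Pos × Pos → Set
(P , Q) ≈² (P' , Q') = P ≈ P' × Q ≈ Q'

≈-refl : (P : Pos) → P ≈ P
≋-refl : (xs : List (Pos × Pos)) → xs ≋ xs
≈-refl ⟨ xs ⟩ = ⟨ ≋-refl xs ⟩
≋-refl [] = []
≋-refl ((P , Q) ∷ xs) = cons {ys = []} (≈-refl P) (≈-refl Q) (≋-refl xs)

-- The constructor of _≋_ inserts at a position given by an append; reasoning about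
-- it is easier with insertion as an inductive relation.
data Insert {A : Set} (b : A) : List A → List A → Set where
  here  : ∀ {ws} → Insert b ws (b ∷ ws)
  there : ∀ {w ws ws'} → Insert b ws ws' → Insert b (w ∷ ws) (w ∷ ws')

Insert-++ : {A : Set} (b : A) (ys zs : List A) → Insert b (ys ++ zs) (ys ++ b ∷ zs)
Insert-++ b []       zs = here
Insert-++ b (y ∷ ys) zs = there (Insert-++ b ys zs)

Insert⇒++ : {A : Set} {b : A} {ws ws' : List A} → Insert b ws ws' →
  Σ[ ys ∈ List A ] Σ[ zs ∈ List A ] ws ≡ ys ++ zs × ws' ≡ ys ++ b ∷ zs
Insert⇒++ (here {ws}) = [] , ws , refl , refl
Insert⇒++ (there {w} i) with Insert⇒++ i
... | ys , zs , refl , refl = w ∷ ys , zs , refl , refl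

Insert-swap : {A : Set} {c d : A} {us' us vs : List A} → Insert c us' us → Insert d us vs →
  Σ[ us'' ∈ List A ] Insert d us' us'' × Insert c us'' vs
Insert-swap ic         here       = _ , here , there ic
Insert-swap here       (there id) = _ , id , here
Insert-swap (there ic) (there id) with Insert-swap ic id
... | _ , id' , ic' = _ , there id' , there ic'

data _≋′_ : List (Pos × Pos) → List (Pos × Pos) → Set where
  []   : [] ≋′ []
  cons : ∀ {a b xs ws ws'} → a ≈² b → Insert b ws ws' → xs ≋′ ws → (a ∷ xs) ≋′ ws'

≋⇒≋′ : ∀ {xs ys} → xs ≋ ys → xs ≋′ ys
≋⇒≋′ [] = []
≋⇒≋′ (cons {b = b} {ys = ys} {zs} p q r) = cons (p , q) (Insert-++ b ys zs) (≋⇒≋′ r)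

≋′⇒≋ : ∀ {xs ys} → xs ≋′ ys → xs ≋ ys
≋′⇒≋ [] = []
≋′⇒≋ (cons (p , q) i r) with Insert⇒++ i
... | ys , zs , refl , refl = cons p q (≋′⇒≋ r)

≋′-remove : ∀ {b ws ws' vs} → Insert b ws ws' → ws' ≋′ vs →
  Σ[ c ∈ Pos × Pos ] Σ[ vs' ∈ List (Pos × Pos) ] b ≈² c × Insert c vs' vs × ws ≋′ vs'
≋′-remove here      (cons p i r) = _ , _ , p , i , r
≋′-remove (there i) (cons p id r) with ≋′-remove i r
... | c , us' , bc , ic , r' with Insert-swap ic id
... | us'' , id' , ic' = c , us'' , bc , ic' , cons p id' r'

≋′-insert : ∀ {a b ws ws' xs xs'} → Insert b ws ws' → Insert a xs xs' → b ≈² a →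
  ws ≋′ xs → ws' ≋′ xs'
≋′-insert here       ia ba r               = cons ba ia r
≋′-insert (there ib) ia ba (cons we ie r) with Insert-swap ie ia
... | _ , ia' , ie' = cons we ie' (≋′-insert ib ia' ba r)

≈-sym : ∀ {P Q} → P ≈ Q → Q ≈ P
≋-sym : ∀ {xs ys} → xs ≋ ys → ys ≋ xs
≈-sym ⟨ p ⟩ = ⟨ ≋-sym p ⟩
≋-sym [] = []
≋-sym (cons {b = b} {ys = ys} {zs} p q r) =
  ≋′⇒≋ (≋′-insert (Insert-++ b ys zs) here (≈-sym p , ≈-sym q) (≋⇒≋′ (≋-sym r)))

≈-trans : ∀ {P Q R} → P ≈ Q → Q ≈ R → P ≈ R
≋-trans : ∀ {xs ys zs} → xs ≋ ys → ys ≋ zs → xs ≋ zs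
≈-trans ⟨ p ⟩ ⟨ q ⟩ = ⟨ ≋-trans p q ⟩
≋-trans [] q = q
≋-trans (cons {b = b} {ys = ys} {zs} p q r) s with ≋′-remove (Insert-++ b ys zs) (≋⇒≋′ s)
... | _ , _ , (p' , q') , ic , r' with Insert⇒++ ic
... | _ , _ , refl , refl = cons (≈-trans p p') (≈-trans q q') (≋-trans r (≋′⇒≋ r'))

≋-++⁺ : ∀ {xs xs' ys ys'} → xs ≋ xs' → ys ≋ ys' → (xs ++ ys) ≋ (xs' ++ ys')
≋-++⁺ [] q = q
≋-++⁺ {ys' = ys'} (cons {b = b} {ys = us} {zs} p q r) s =
  ≡-subst (_ ≋_) (sym (++-assoc us (b ∷ zs) ys'))
    (cons {ys = us} p q (≡-subst (_ ≋_) (++-assoc us zs ys') (≋-++⁺ r s)))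

≋-++-comm : (xs ys : List (Pos × Pos)) → (xs ++ ys) ≋ (ys ++ xs)
≋-++-comm []       ys = ≡-subst (ys ≋_) (sym (++-identityʳ ys)) (≋-refl ys)
≋-++-comm (x ∷ xs) ys = cons {ys = ys} (≈-refl _) (≈-refl _) (≋-++-comm xs ys)

≡⇒≈ : ∀ {P Q} → P ≡ Q → P ≈ Q
≡⇒≈ {P} refl = ≈-refl P

⊎ₚ-assoc : ∀ P Q R → ((P ⊎ₚ Q) ⊎ₚ R) ≡ (P ⊎ₚ (Q ⊎ₚ R))
⊎ₚ-assoc ⟨ xs ⟩ ⟨ ys ⟩ ⟨ zs ⟩ = cong ⟨_⟩ (++-assoc xs ys zs)

⊎ₚ-identityˡ : ∀ P → (𝟘 ⊎ₚ P) ≡ P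
⊎ₚ-identityˡ ⟨ xs ⟩ = refl

⊎ₚ-identityʳ : ∀ P → (P ⊎ₚ 𝟘) ≡ P
⊎ₚ-identityʳ ⟨ xs ⟩ = cong ⟨_⟩ (++-identityʳ xs)

⊎ₚ-cong : ∀ {P P' Q Q'} → P ≈ P' → Q ≈ Q' → (P ⊎ₚ Q) ≈ (P' ⊎ₚ Q')
⊎ₚ-cong ⟨ p ⟩ ⟨ q ⟩ = ⟨ ≋-++⁺ p q ⟩

⊎ₚ-comm : ∀ P Q → (P ⊎ₚ Q) ≈ (Q ⊎ₚ P)
⊎ₚ-comm ⟨ xs ⟩ ⟨ ys ⟩ = ⟨ ≋-++-comm xs ys ⟩

𝟘≈⇒≡𝟘 : ∀ {P} → 𝟘 ≈ P → P ≡ 𝟘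
𝟘≈⇒≡𝟘 ⟨ [] ⟩ = refl

≈𝟘⇒≡𝟘 : ∀ {P} → P ≈ 𝟘 → P ≡ 𝟘
≈𝟘⇒≡𝟘 p = 𝟘≈⇒≡𝟘 (≈-sym p)

⊎ₚ≡𝟘⇒ : ∀ P Q → (P ⊎ₚ Q) ≡ 𝟘 → P ≡ 𝟘 × Q ≡ 𝟘
⊎ₚ≡𝟘⇒ ⟨ [] ⟩ ⟨ [] ⟩ refl = refl , refl

≈ₑ-refl : ∀ {n} (Γ : Env n) → Γ ≈ₑ Γ
≈ₑ-refl Γ = Pointwise.refl (≈-refl _)

≈ₑ-sym : ∀ {n} {Γ Δ : Env n} → Γ ≈ₑ Δ → Δ ≈ₑ Γ
≈ₑ-sym = Pointwise.sym ≈-sym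

≈ₑ-trans : ∀ {n} {Γ Δ Θ : Env n} → Γ ≈ₑ Δ → Δ ≈ₑ Θ → Γ ≈ₑ Θ
≈ₑ-trans = Pointwise.trans ≈-trans

≡⇒≈ₑ : ∀ {n} {Γ Δ : Env n} → Γ ≡ Δ → Γ ≈ₑ Δ
≡⇒≈ₑ {Γ = Γ} refl = ≈ₑ-refl Γ

⊎ₑ-cong : ∀ {n} {Γ Γ' Δ Δ' : Env n} → Γ ≈ₑ Γ' → Δ ≈ₑ Δ' → (Γ ⊎ₑ Δ) ≈ₑ (Γ' ⊎ₑ Δ')
⊎ₑ-cong []       []       = []
⊎ₑ-cong (p ∷ ps) (q ∷ qs) = ⊎ₚ-cong p q ∷ ⊎ₑ-cong ps qs

⊎ₑ-comm : ∀ {n} (Γ Δ : Env n) → (Γ ⊎ₑ Δ) ≈ₑ (Δ ⊎ₑ Γ)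
⊎ₑ-comm []      []      = []
⊎ₑ-comm (P ∷ Γ) (Q ∷ Δ) = ⊎ₚ-comm P Q ∷ ⊎ₑ-comm Γ Δ

⊎ₑ-assoc : ∀ {n} (Γ Δ Θ : Env n) → ((Γ ⊎ₑ Δ) ⊎ₑ Θ) ≡ (Γ ⊎ₑ (Δ ⊎ₑ Θ))
⊎ₑ-assoc = zipWith-assoc ⊎ₚ-assoc

⊎ₑ-identityˡ : ∀ {n} (Γ : Env n) → (∅ ⊎ₑ Γ) ≡ Γ
⊎ₑ-identityˡ = zipWith-identityˡ ⊎ₚ-identityˡ

⊎ₑ-identityʳ : ∀ {n} (Γ : Env n) → (Γ ⊎ₑ ∅) ≡ Γ
⊎ₑ-identityʳ = zipWith-identityʳ ⊎ₚ-identityʳ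

⊎ₑ-commutativeMonoid : ℕ → CommutativeMonoid _ _
⊎ₑ-commutativeMonoid n = record
  { Carrier = Env n ; _≈_ = _≈ₑ_ ; _∙_ = _⊎ₑ_ ; ε = ∅
  ; isCommutativeMonoid = record
    { isMonoid = record
      { isSemigroup = record
        { isMagma = record
          { isEquivalence = record { refl = ≈ₑ-refl _ ; sym = ≈ₑ-sym ; trans = ≈ₑ-trans }
          ; ∙-cong = ⊎ₑ-cong }
        ; assoc = λ Γ Δ Θ → ≡⇒≈ₑ (⊎ₑ-assoc Γ Δ Θ) }
      ; identity = (λ Γ → ≡⇒≈ₑ (⊎ₑ-identityˡ Γ)) , (λ Γ → ≡⇒≈ₑ (⊎ₑ-identityʳ Γ)) }
    ; comm = ⊎ₑ-comm } }

module ⊎ₑ-Properties {n : ℕ} =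
  CommSemigroupProperties (CommutativeMonoid.commutativeSemigroup (⊎ₑ-commutativeMonoid n))

module ≈ₑ-Reasoning {n : ℕ} = SetoidReasoning (CommutativeMonoid.setoid (⊎ₑ-commutativeMonoid n))

≈ₑ∅⇒≡∅ : ∀ {n} {Γ : Env n} → Γ ≈ₑ ∅ → Γ ≡ ∅
≈ₑ∅⇒≡∅ []       = refl
≈ₑ∅⇒≡∅ (p ∷ ps) = cong₂ _∷_ (≈𝟘⇒≡𝟘 p) (≈ₑ∅⇒≡∅ ps)

⊎ₑ≡∅⇒ : ∀ {n} (Γ Δ : Env n) → (Γ ⊎ₑ Δ) ≡ ∅ → Γ ≡ ∅ × Δ ≡ ∅
⊎ₑ≡∅⇒ []      []      refl = refl , refl
⊎ₑ≡∅⇒ (P ∷ Γ) (Q ∷ Δ) e with ∷-injective e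
... | eP , eΓ with ⊎ₚ≡𝟘⇒ P Q eP | ⊎ₑ≡∅⇒ Γ Δ eΓ
... | refl , refl | refl , refl = refl , refl

removeAt-⊎ₑ : ∀ {n} (Γ Δ : Env (suc n)) i → removeAt (Γ ⊎ₑ Δ) i ≡ (removeAt Γ i ⊎ₑ removeAt Δ i)
removeAt-⊎ₑ         (P ∷ Γ) (Q ∷ Δ) zero    = refl
removeAt-⊎ₑ {suc n} (P ∷ Γ@(_ ∷ _)) (Q ∷ Δ@(_ ∷ _)) (suc i) = cong (_ ∷_) (removeAt-⊎ₑ Γ Δ i)

insertAt-⊎ₑ : ∀ {n} (Γ Δ : Env n) i → insertAt (Γ ⊎ₑ Δ) i 𝟘 ≡ (insertAt Γ i 𝟘 ⊎ₑ insertAt Δ i 𝟘)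
insertAt-⊎ₑ Γ       Δ       zero    = refl
insertAt-⊎ₑ (P ∷ Γ) (Q ∷ Δ) (suc i) = cong (_ ∷_) (insertAt-⊎ₑ Γ Δ i)

insertAt-∅ : ∀ {n} (i : Fin (suc n)) → insertAt (∅ {n}) i 𝟘 ≡ ∅
insertAt-∅         zero    = refl
insertAt-∅ {suc n} (suc i) = cong (𝟘 ∷_) (insertAt-∅ i)

lookup-↦ₑ-punchIn : ∀ {n} (i : Fin (suc n)) (k : Fin n) P → lookup (punchIn i k ↦ₑ P) i ≡ 𝟘
lookup-↦ₑ-punchIn i k P = trans (lookup∘update′ (punchInᵢ≢i i k ∘ sym) ∅ P) (lookup-replicate i 𝟘)

insertAt-↦ₑ : ∀ {n} (i : Fin (suc n)) (x : Fin n) P → insertAt (x ↦ₑ P) i 𝟘 ≡ (punchIn i x ↦ₑ P)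
insertAt-↦ₑ zero    x       P = refl
insertAt-↦ₑ (suc i) zero    P = cong (P ∷_) (insertAt-∅ i)
insertAt-↦ₑ (suc i) (suc x) P = cong (𝟘 ∷_) (insertAt-↦ₑ i x P)

↦ₑ-insertAt : ∀ {n} (i : Fin (suc n)) P → (i ↦ₑ P) ≡ insertAt ∅ i P
↦ₑ-insertAt         zero    P = refl
↦ₑ-insertAt {suc n} (suc i) P = cong (𝟘 ∷_) (↦ₑ-insertAt i P)

removeAt-∅ : ∀ {n} (i : Fin (suc n)) → removeAt (∅ {suc n}) i ≡ ∅
removeAt-∅ i = trans (cong (λ Γ → removeAt Γ i) (sym (insertAt-∅ i))) (removeAt-insertAt ∅ i 𝟘)

removeAt-↦ₑ : ∀ {n} (i : Fin (suc n)) P → removeAt (i ↦ₑ P) i ≡ ∅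
removeAt-↦ₑ i P = trans (cong (λ Γ → removeAt Γ i) (↦ₑ-insertAt i P)) (removeAt-insertAt ∅ i P)

removeAt-↦ₑ-punchIn : ∀ {n} (i : Fin (suc n)) (k : Fin n) P → removeAt (punchIn i k ↦ₑ P) i ≡ (k ↦ₑ P)
removeAt-↦ₑ-punchIn i k P =
  trans (cong (λ Γ → removeAt Γ i) (sym (insertAt-↦ₑ i k P))) (removeAt-insertAt (k ↦ₑ P) i 𝟘)

↦ₑ-𝟘 : ∀ {n} (x : Fin n) → (x ↦ₑ 𝟘) ≡ ∅
↦ₑ-𝟘 zero    = refl
↦ₑ-𝟘 (suc x) = cong (𝟘 ∷_) (↦ₑ-𝟘 x)

↦ₑ-⊎ₚ : ∀ {n} (x : Fin n) P Q → (x ↦ₑ (P ⊎ₚ Q)) ≡ ((x ↦ₑ P) ⊎ₑ (x ↦ₑ Q))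
↦ₑ-⊎ₚ zero    P Q = cong ((P ⊎ₚ Q) ∷_) (sym (⊎ₑ-identityˡ ∅))
↦ₑ-⊎ₚ (suc x) P Q = cong (𝟘 ∷_) (↦ₑ-⊎ₚ x P Q)

↦ₑ-cong : ∀ {n} (x : Fin n) {P Q} → P ≈ Q → (x ↦ₑ P) ≈ₑ (x ↦ₑ Q)
↦ₑ-cong zero    p = p ∷ ≈ₑ-refl _
↦ₑ-cong (suc x) p = ≈-refl 𝟘 ∷ ↦ₑ-cong x p

removeAt-cong : ∀ {n} {Γ Δ : Env (suc n)} i → Γ ≈ₑ Δ → removeAt Γ i ≈ₑ removeAt Δ i
removeAt-cong         zero    (p ∷ ps) = ps
removeAt-cong {suc n} {_ ∷ _ ∷ _} {_ ∷ _ ∷ _} (suc i) (p ∷ ps) = p ∷ removeAt-cong i ps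

insertAt-cong : ∀ {n} {Γ Δ : Env n} i → Γ ≈ₑ Δ → insertAt Γ i 𝟘 ≈ₑ insertAt Δ i 𝟘
insertAt-cong zero    ps       = ≈-refl 𝟘 ∷ ps
insertAt-cong (suc i) (p ∷ ps) = p ∷ insertAt-cong i ps

ext-cong : ∀ {m n} {ρ ρ' : Fin m → Fin n} → ρ ≗ ρ' → ext ρ ≗ ext ρ'
ext-cong e zero    = refl
ext-cong e (suc x) = cong suc (e x)

rename-cong : ∀ {m n} {ρ ρ' : Fin m → Fin n} → ρ ≗ ρ' → ∀ t → rename ρ t ≡ rename ρ' t
rename-cong e (var x)   = cong var (e x)
rename-cong e (lam t)   = cong lam (rename-cong (ext-cong e) t)
rename-cong e (app t u) = cong₂ app (rename-cong e t) (rename-cong e u)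

exts-cong : ∀ {m n} {σ τ : Fin m → Term n} → σ ≗ τ → exts σ ≗ exts τ
exts-cong e zero    = refl
exts-cong e (suc x) = cong weaken (e x)

subst-cong : ∀ {m n} {σ τ : Fin m → Term n} → σ ≗ τ → ∀ t → subst σ t ≡ subst τ t
subst-cong e (var x)   = e x
subst-cong e (lam t)   = cong lam (subst-cong (exts-cong e) t)
subst-cong e (app t u) = cong₂ app (subst-cong e t) (subst-cong e u)

ext-punchIn : ∀ {n} (i : Fin (suc n)) → ext (punchIn i) ≗ punchIn (suc i)
ext-punchIn i zero    = refl
ext-punchIn i (suc x) = refl

data PunchIn {n : ℕ} (i : Fin (suc n)) : Fin (suc n) → Set where
  hole    : PunchIn i i
  punched : (k : Fin n) → PunchIn i (punchIn i k)

punchIn-view : ∀ {n} (i j : Fin (suc n)) → PunchIn i j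
punchIn-view zero    zero    = hole
punchIn-view zero    (suc j) = punched j
punchIn-view {suc n} (suc i) zero = punched zero
punchIn-view {suc n} (suc i) (suc j) with punchIn-view i j
... | hole      = hole
... | punched k = punched (suc k)

punchOutᵐ : ∀ {n} → Fin (suc n) → Fin (suc n) → Maybe (Fin n)
punchOutᵐ zero    zero    = nothing
punchOutᵐ zero    (suc j) = just j
punchOutᵐ {suc n} (suc i) zero    = just zero
punchOutᵐ {suc n} (suc i) (suc j) = Maybe.map suc (punchOutᵐ i j)

punchOutᵐ-self : ∀ {n} (i : Fin (suc n)) → punchOutᵐ i i ≡ nothing
punchOutᵐ-self zero = refl
punchOutᵐ-self {suc n} (suc i) = cong (Maybe.map suc) (punchOutᵐ-self i)

punchOutᵐ-punchIn : ∀ {n} (i : Fin (suc n)) (k : Fin n) → punchOutᵐ i (punchIn i k) ≡ just k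
punchOutᵐ-punchIn zero    k = refl
punchOutᵐ-punchIn {suc n} (suc i) zero    = refl
punchOutᵐ-punchIn {suc n} (suc i) (suc k) = cong (Maybe.map suc) (punchOutᵐ-punchIn i k)

substAt : ∀ {n} → Fin (suc n) → Term n → Fin (suc n) → Term n
substAt i v j = maybe var v (punchOutᵐ i j)

substAt-self : ∀ {n} (i : Fin (suc n)) v → substAt i v i ≡ v
substAt-self i v = cong (maybe var v) (punchOutᵐ-self i)

substAt-punchIn : ∀ {n} (i : Fin (suc n)) v k → substAt i v (punchIn i k) ≡ var k
substAt-punchIn i v k = cong (maybe var v) (punchOutᵐ-punchIn i k)

single≗substAt₀ : ∀ {n} (v : Term n) → single v ≗ substAt zero v
single≗substAt₀ v zero    = refl
single≗substAt₀ v (suc j) = refl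

exts-substAt : ∀ {n} (i : Fin (suc n)) (v : Term n) → exts (substAt i v) ≗ substAt (suc i) (weaken v)
exts-substAt i v zero = refl
exts-substAt i v (suc j) with punchOutᵐ i j
... | nothing = refl
... | just k  = refl

#app : ∀ {n} {Γ : Env n} {t Q} → Γ ⊢ t ∶ Q → ℕ
#appᴾ : ∀ {n} {t : Term (suc n)} {Γ ps} → Premises t Γ ps → ℕ
#app (ax _)       = 0
#app (lam ps _ _) = #appᴾ ps
#app (app d e _)  = suc (#app d + #app e)
#appᴾ []       = 0
#appᴾ (d ∷ ps) = #app d + #appᴾ ps

convert : ∀ {n} {Γ Γ' : Env n} {t Q Q'} → Γ ≈ₑ Γ' → Q ≈ Q' → (D : Γ ⊢ t ∶ Q) →
  Σ[ D' ∈ Γ' ⊢ t ∶ Q' ] #app D' ≡ #app D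
convert g q (ax {x = x} e)  = ax (≈ₑ-trans (≈ₑ-sym g) (≈ₑ-trans e (↦ₑ-cong x q))) , refl
convert g q (lam ps e r)    = lam ps (≈ₑ-trans (≈ₑ-sym g) e) (≈-trans (≈-sym q) r) , refl
convert g q (app {P = P} d e θ) with convert (≈ₑ-refl _) ⟨ cons {ys = []} (≈-refl P) q [] ⟩ d
... | d' , eq = app d' e (≈ₑ-trans (≈ₑ-sym g) θ) , cong (λ m → suc (m + #app e)) eq

convertEnv : ∀ {n} {Γ Γ' : Env n} {t Q} → Γ ≈ₑ Γ' → (D : Γ ⊢ t ∶ Q) →
  Σ[ D' ∈ Γ' ⊢ t ∶ Q ] #app D' ≡ #app D
convertEnv g = convert g (≈-refl _)

cast : ∀ {n} {Γ : Env n} {t t' Q Q'} → t ≡ t' → Q ≡ Q' → (D : Γ ⊢ t ∶ Q) →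
  Σ[ D' ∈ Γ ⊢ t' ∶ Q' ] #app D' ≡ #app D
cast refl refl D = D , refl

castᴾ : ∀ {n} {Γ : Env n} {t t' : Term (suc n)} {ps} → t ≡ t' → (P : Premises t Γ ps) →
  Σ[ P' ∈ Premises t' Γ ps ] #appᴾ P' ≡ #appᴾ P
castᴾ refl P = P , refl

module ℕ+ = CommSemigroupProperties ℕ.+-commutativeSemigroup

Premises-insert : ∀ {n} {t : Term (suc n)} {Γ Γd : Env n} {P Q} (ys : List (Pos × Pos)) {zs} →
  (ps : Premises t Γ (ys ++ zs)) → (d : (P ∷ Γd) ⊢ t ∶ Q) →
  Σ[ Γ' ∈ Env n ] Σ[ ps' ∈ Premises t Γ' (ys ++ (P , Q) ∷ zs) ]
    Γ' ≈ₑ (Γd ⊎ₑ Γ) × #appᴾ ps' ≡ #app d + #appᴾ ps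
Premises-insert []       ps d = _ , d ∷ ps , ≈ₑ-refl _ , refl
Premises-insert {Γd = Γd} (y ∷ ys) (_∷_ {Γ = Γe} {Δ = Γr} e ps) d with Premises-insert ys ps d
... | Γ' , ps' , g , eq = Γe ⊎ₑ Γ' , e ∷ ps' ,
  ≈ₑ-trans (⊎ₑ-cong (≈ₑ-refl Γe) g) (⊎ₑ-Properties.x∙yz≈y∙xz Γe Γd Γr) ,
  trans (cong (#app e +_) eq) (ℕ+.x∙yz≈y∙xz (#app e) (#app d) (#appᴾ ps))

Premises-≋ : ∀ {n} {t : Term (suc n)} {Γ : Env n} {ps qs} → (P : Premises t Γ ps) → ps ≋ qs →
  Σ[ Γ' ∈ Env n ] Σ[ P' ∈ Premises t Γ' qs ] Γ ≈ₑ Γ' × #appᴾ P' ≡ #appᴾ P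
Premises-≋ [] [] = _ , [] , ≈ₑ-refl _ , refl
Premises-≋ (_∷_ {Γ = Γd} d P) (cons {ys = ys} p q r) with Premises-≋ P r
... | Γ' , P' , g , eq with convert (p ∷ ≈ₑ-refl Γd) q d
... | d' , eq' with Premises-insert ys P' d'
... | Γ'' , P'' , g' , eq'' =
  Γ'' , P'' , ≈ₑ-trans (⊎ₑ-cong (≈ₑ-refl Γd) g) (≈ₑ-sym g') , trans eq'' (cong₂ _+_ eq' eq)

Premises-++ : ∀ {n} {t : Term (suc n)} {Γ₁ Γ₂ : Env n} {as bs} →
  (P₁ : Premises t Γ₁ as) → (P₂ : Premises t Γ₂ bs) →
  Σ[ Γ ∈ Env n ] Σ[ P ∈ Premises t Γ (as ++ bs) ] Γ ≈ₑ (Γ₁ ⊎ₑ Γ₂) × #appᴾ P ≡ #appᴾ P₁ + #appᴾ P₂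
Premises-++ {Γ₂ = Γ₂} [] P₂ = _ , P₂ , ≡⇒≈ₑ (sym (⊎ₑ-identityˡ Γ₂)) , refl
Premises-++ {Γ₂ = Γ₂} (_∷_ {Γ = Γd} {Δ = Γr} d P₁) P₂ with Premises-++ P₁ P₂
... | Γ , P , g , eq = Γd ⊎ₑ Γ , d ∷ P ,
  ≈ₑ-trans (⊎ₑ-cong (≈ₑ-refl Γd) g) (≡⇒≈ₑ (sym (⊎ₑ-assoc Γd Γr Γ₂))) ,
  trans (cong (#app d +_) eq) (sym (ℕ.+-assoc (#app d) (#appᴾ P₁) (#appᴾ P₂)))

Premises-split : ∀ {n} {t : Term (suc n)} {Γ : Env n} (as : List (Pos × Pos)) {bs} →
  (P : Premises t Γ (as ++ bs)) →
  Σ[ Γ₁ ∈ Env n ] Σ[ Γ₂ ∈ Env n ] Σ[ P₁ ∈ Premises t Γ₁ as ] Σ[ P₂ ∈ Premises t Γ₂ bs ]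
    Γ ≈ₑ (Γ₁ ⊎ₑ Γ₂) × #appᴾ P₁ + #appᴾ P₂ ≡ #appᴾ P
Premises-split {Γ = Γ} [] P = ∅ , Γ , [] , P , ≡⇒≈ₑ (sym (⊎ₑ-identityˡ Γ)) , refl
Premises-split (a ∷ as) (_∷_ {Γ = Γd} d P) with Premises-split as P
... | Γ₁ , Γ₂ , P₁ , P₂ , g , eq = Γd ⊎ₑ Γ₁ , Γ₂ , d ∷ P₁ , P₂ ,
  ≈ₑ-trans (⊎ₑ-cong (≈ₑ-refl Γd) g) (≡⇒≈ₑ (sym (⊎ₑ-assoc Γd Γ₁ Γ₂))) ,
  trans (ℕ.+-assoc (#app d) (#appᴾ P₁) (#appᴾ P₂)) (cong (#app d +_) eq)

lam-inversion : ∀ {n} {Γ : Env n} {t P Q} → (D : Γ ⊢ lam t ∶ ⟨ (P , Q) ∷ [] ⟩) →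
  Σ[ Γ' ∈ Env n ] Σ[ d ∈ (P ∷ Γ') ⊢ t ∶ Q ] Γ ≈ₑ Γ' × #app d ≡ #app D
lam-inversion (lam ps e ⟨ r ⟩) with Premises-≋ ps (≋-sym r)
... | _ , _∷_ {Γ = Γ'} d [] , g , eq =
  Γ' , d , ≈ₑ-trans e (≈ₑ-trans g (≡⇒≈ₑ (⊎ₑ-identityʳ Γ'))) , trans (sym (ℕ.+-identityʳ (#app d))) eq

lam-intro : ∀ {n} {Γ : Env n} {t P Q} → (d : (P ∷ Γ) ⊢ t ∶ Q) →
  Σ[ D ∈ Γ ⊢ lam t ∶ ⟨ (P , Q) ∷ [] ⟩ ] #app D ≡ #app d
lam-intro {Γ = Γ} d = lam (d ∷ []) (≡⇒≈ₑ (sym (⊎ₑ-identityʳ Γ))) (≈-refl _) , ℕ.+-identityʳ (#app d)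

value-𝟘 : ∀ {n} {v : Term n} → Value v → Σ[ D ∈ ∅ ⊢ v ∶ 𝟘 ] #app D ≡ 0
value-𝟘 (var x) = ax (≡⇒≈ₑ (sym (↦ₑ-𝟘 x))) , refl
value-𝟘 (lam t) = lam [] (≈ₑ-refl _) (≈-refl 𝟘) , refl

value-𝟘⇒∅ : ∀ {n} {v : Term n} {Γ} → Value v → Γ ⊢ v ∶ 𝟘 → Γ ≡ ∅
value-𝟘⇒∅ (var x) (ax e) = ≈ₑ∅⇒≡∅ (≈ₑ-trans e (≡⇒≈ₑ (↦ₑ-𝟘 x)))
value-𝟘⇒∅ (lam t) (lam ps e r) with 𝟘≈⇒≡𝟘 r
value-𝟘⇒∅ (lam t) (lam [] e r) | refl = ≈ₑ∅⇒≡∅ e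

value-merge : ∀ {n} {v : Term n} {Γ₁ Γ₂ P₁ P₂} → Value v → Γ₁ ⊢ v ∶ P₁ → Γ₂ ⊢ v ∶ P₂ →
  (Γ₁ ⊎ₑ Γ₂) ⊢ v ∶ (P₁ ⊎ₚ P₂)
value-merge {P₁ = P₁} {P₂} (var x) (ax e₁) (ax e₂) =
  ax (≈ₑ-trans (⊎ₑ-cong e₁ e₂) (≡⇒≈ₑ (sym (↦ₑ-⊎ₚ x P₁ P₂))))
value-merge (lam t) (lam ps₁ e₁ r₁) (lam ps₂ e₂ r₂) with Premises-++ ps₁ ps₂
... | _ , ps , g , _ = lam ps (≈ₑ-trans (⊎ₑ-cong e₁ e₂) (≈ₑ-sym g)) (⊎ₚ-cong r₁ r₂)

value-split : ∀ {n} {v : Term n} {Γ} P₁ P₂ → Value v → (D : Γ ⊢ v ∶ (P₁ ⊎ₚ P₂)) →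
  Σ[ Γ₁ ∈ Env n ] Σ[ Γ₂ ∈ Env n ] Σ[ D₁ ∈ Γ₁ ⊢ v ∶ P₁ ] Σ[ D₂ ∈ Γ₂ ⊢ v ∶ P₂ ]
    Γ ≈ₑ (Γ₁ ⊎ₑ Γ₂) × #app D₁ + #app D₂ ≡ #app D
value-split P₁ P₂ (var x) (ax e) =
  x ↦ₑ P₁ , x ↦ₑ P₂ , ax (≈ₑ-refl _) , ax (≈ₑ-refl _) , ≈ₑ-trans e (≡⇒≈ₑ (↦ₑ-⊎ₚ x P₁ P₂)) , refl
value-split ⟨ as ⟩ ⟨ bs ⟩ (lam t) (lam ps e ⟨ r ⟩) with Premises-≋ ps (≋-sym r)
... | _ , ps' , g , eq with Premises-split as ps'
... | Γ₁ , Γ₂ , ps₁ , ps₂ , g' , eq' =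
  Γ₁ , Γ₂ , lam ps₁ (≈ₑ-refl _) (≈-refl _) , lam ps₂ (≈ₑ-refl _) (≈-refl _) ,
  ≈ₑ-trans e (≈ₑ-trans g g') , trans eq' eq

rename-Value : ∀ {m n} {v : Term m} (ρ : Fin m → Fin n) → Value v → Value (rename ρ v)
rename-Value ρ (var x) = var (ρ x)
rename-Value ρ (lam t) = lam _

rename-ext-punchIn : ∀ {n} (i : Fin (suc n)) (t : Term (suc n)) →
  rename (punchIn (suc i)) t ≡ rename (ext (punchIn i)) t
rename-ext-punchIn i = rename-cong (λ x → sym (ext-punchIn i x))

⊢-weaken : ∀ {n} {Γ : Env n} {t Q} (i : Fin (suc n)) → (D : Γ ⊢ t ∶ Q) →
  Σ[ D' ∈ insertAt Γ i 𝟘 ⊢ rename (punchIn i) t ∶ Q ] #app D' ≡ #app D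
Premises-weaken : ∀ {n} {Γ : Env n} {t ps} (i : Fin (suc n)) → (P : Premises t Γ ps) →
  Σ[ Γ' ∈ Env (suc n) ] Σ[ P' ∈ Premises (rename (punchIn (suc i)) t) Γ' ps ]
    insertAt Γ i 𝟘 ≈ₑ Γ' × #appᴾ P' ≡ #appᴾ P
⊢-weaken i (ax {x = x} {P = Q} e) = ax (≈ₑ-trans (insertAt-cong i e) (≡⇒≈ₑ (insertAt-↦ₑ i x Q))) , refl
⊢-weaken {t = lam t} i (lam ps e r) with Premises-weaken i ps
... | _ , ps' , g , eq with castᴾ (rename-ext-punchIn i t) ps'
... | ps'' , eq' = lam ps'' (≈ₑ-trans (insertAt-cong i e) g) r , trans eq' eq
⊢-weaken i (app {Γ = Γ₁} {Δ = Γ₂} d e θ) with ⊢-weaken i d | ⊢-weaken i e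
... | d' , eq₁ | e' , eq₂ =
  app d' e' (≈ₑ-trans (insertAt-cong i θ) (≡⇒≈ₑ (insertAt-⊎ₑ Γ₁ Γ₂ i))) ,
  cong₂ (λ a b → suc (a + b)) eq₁ eq₂
Premises-weaken i [] = ∅ , [] , ≡⇒≈ₑ (insertAt-∅ i) , refl
Premises-weaken i (_∷_ {Γ = Γd} {Δ = Γr} d ps) with ⊢-weaken (suc i) d | Premises-weaken i ps
... | d' , eq₁ | Γ' , ps' , g , eq₂ = insertAt Γd i 𝟘 ⊎ₑ Γ' , d' ∷ ps' ,
  ≈ₑ-trans (≡⇒≈ₑ (insertAt-⊎ₑ Γd Γr i)) (⊎ₑ-cong (≈ₑ-refl _) g) , cong₂ _+_ eq₁ eq₂

⊢-strengthen : ∀ {n} {Γ : Env (suc n)} {Q} (i : Fin (suc n)) (t : Term n) →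
  Γ ⊢ rename (punchIn i) t ∶ Q → Σ[ Γ' ∈ Env n ] Γ' ⊢ t ∶ Q × Γ ≈ₑ insertAt Γ' i 𝟘
Premises-strengthen : ∀ {n} {Γ : Env (suc n)} {ps} (i : Fin (suc n)) (t : Term (suc n)) →
  Premises (rename (punchIn (suc i)) t) Γ ps →
  Σ[ Γ' ∈ Env n ] Premises t Γ' ps × Γ ≈ₑ insertAt Γ' i 𝟘
⊢-strengthen {Q = Q} i (var x) (ax e) =
  x ↦ₑ Q , ax (≈ₑ-refl _) , ≈ₑ-trans e (≡⇒≈ₑ (sym (insertAt-↦ₑ i x Q)))
⊢-strengthen i (lam t) (lam ps e r)
  with Premises-strengthen i t (proj₁ (castᴾ (sym (rename-ext-punchIn i t)) ps))
... | Γ' , ps' , g = Γ' , lam ps' (≈ₑ-refl _) r , ≈ₑ-trans e g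
⊢-strengthen i (app t u) (app d e θ) with ⊢-strengthen i t d | ⊢-strengthen i u e
... | Γ₁ , d' , g₁ | Γ₂ , e' , g₂ = Γ₁ ⊎ₑ Γ₂ , app d' e' (≈ₑ-refl _) ,
  ≈ₑ-trans θ (≈ₑ-trans (⊎ₑ-cong g₁ g₂) (≡⇒≈ₑ (sym (insertAt-⊎ₑ Γ₁ Γ₂ i))))
Premises-strengthen i t [] = ∅ , [] , ≡⇒≈ₑ (sym (insertAt-∅ i))
Premises-strengthen i t (d ∷ ps) with ⊢-strengthen (suc i) t d | Premises-strengthen i t ps
... | P ∷ Γd , d' , p ∷ g | Γ' , ps' , g' with convertEnv (≈-sym p ∷ ≈ₑ-refl Γd) d'
... | d'' , _ = Γd ⊎ₑ Γ' , d'' ∷ ps' , ≈ₑ-trans (⊎ₑ-cong g g') (≡⇒≈ₑ (sym (insertAt-⊎ₑ Γd Γ' i)))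

⊢-subst-var : ∀ {n} {Θ : Env (suc n)} {Δ x Q} {v : Term n} (i : Fin (suc n)) → Value v →
  Θ ≈ₑ (x ↦ₑ Q) → (Dv : Δ ⊢ v ∶ lookup Θ i) →
  Σ[ D' ∈ (removeAt Θ i ⊎ₑ Δ) ⊢ substAt i v x ∶ Q ] #app D' ≤ #app Dv
⊢-subst-var {Θ = Θ} {Δ} {x} {Q} {v} i isV e Dv with punchIn-view i x
... | hole with convert
      (≈ₑ-trans (≡⇒≈ₑ (sym (⊎ₑ-identityˡ Δ)))
        (⊎ₑ-cong (≈ₑ-sym (≈ₑ-trans (removeAt-cong i e) (≡⇒≈ₑ (removeAt-↦ₑ i Q)))) (≈ₑ-refl Δ)))
      (≈-trans (Pointwise.lookup e i) (≡⇒≈ (lookup∘update i ∅ Q))) Dv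
... | Dv' , eq with cast (sym (substAt-self i v)) refl Dv'
... | D' , eq' = D' , ℕ.≤-reflexive (trans eq' eq)
⊢-subst-var {Θ = Θ} {Δ} {x} {Q} {v} i isV e Dv | punched k
  -- x ≠ i, so v is typed by 𝟘, which forces Δ = ∅.
  with value-𝟘⇒∅ isV (proj₁ (cast refl (≈𝟘⇒≡𝟘 (≈-trans (Pointwise.lookup e i) (≡⇒≈ (lookup-↦ₑ-punchIn i k Q)))) Dv))
... | refl with cast (sym (substAt-punchIn i v k)) refl
      (ax (≈ₑ-trans (≡⇒≈ₑ (⊎ₑ-identityʳ (removeAt Θ i)))
        (≈ₑ-trans (removeAt-cong i e) (≡⇒≈ₑ (removeAt-↦ₑ-punchIn i k Q)))))
... | D' , eq = D' , ℕ.≤-trans (ℕ.≤-reflexive eq) z≤n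

⊢-subst : ∀ {n} {Θ : Env (suc n)} {t Q Δ} {v : Term n} (i : Fin (suc n)) → Value v →
  (D : Θ ⊢ t ∶ Q) → (Dv : Δ ⊢ v ∶ lookup Θ i) →
  Σ[ D' ∈ (removeAt Θ i ⊎ₑ Δ) ⊢ subst (substAt i v) t ∶ Q ] #app D' ≤ #app D + #app Dv
Premises-subst : ∀ {n} {Θ : Env (suc n)} {s ps Δ} {v : Term n} (i : Fin (suc n)) → Value v →
  (P : Premises s Θ ps) → (Dv : Δ ⊢ v ∶ lookup Θ i) →
  Σ[ Γ' ∈ Env n ] Σ[ P' ∈ Premises (subst (substAt (suc i) (weaken v)) s) Γ' ps ]
    Γ' ≈ₑ (removeAt Θ i ⊎ₑ Δ) × #appᴾ P' ≤ #appᴾ P + #app Dv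
⊢-subst i isV (ax e) Dv = ⊢-subst-var i isV e Dv
⊢-subst {Θ = Θ} {Δ = Δ} {v} i isV (lam {t = s} ps e r) Dv with convert (≈ₑ-refl Δ) (Pointwise.lookup e i) Dv
... | Dv' , eq with Premises-subst i isV ps Dv'
... | Γ' , ps' , g , le with castᴾ (sym (subst-cong (exts-substAt i v) s)) ps'
... | ps'' , eq' =
  lam ps'' (≈ₑ-trans (⊎ₑ-cong (removeAt-cong i e) (≈ₑ-refl Δ)) (≈ₑ-sym g)) r ,
  ℕ.≤-trans (ℕ.≤-reflexive eq') (ℕ.≤-trans le (ℕ.≤-reflexive (cong (#appᴾ ps +_) eq)))
⊢-subst {Θ = Θ} {Δ = Δ} {v} i isV (app {Γ = Γ₁} {Δ = Γ₂} d e θ) Dv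
  with convert (≈ₑ-refl Δ) (≈-trans (Pointwise.lookup θ i) (≡⇒≈ (lookup-zipWith _⊎ₚ_ i Γ₁ Γ₂))) Dv
... | Dv' , eq with value-split (lookup Γ₁ i) (lookup Γ₂ i) isV Dv'
... | Δ₁ , Δ₂ , D₁ , D₂ , g , eq' with ⊢-subst i isV d D₁ | ⊢-subst i isV e D₂
... | d' , le₁ | e' , le₂ = app d' e' env ,
  s≤s (ℕ.≤-trans (ℕ.+-mono-≤ le₁ le₂) (ℕ.≤-reflexive
    (trans (ℕ+.interchange (#app d) (#app D₁) (#app e) (#app D₂))
      (cong ((#app d + #app e) +_) (trans eq' eq)))))
  where
  open ≈ₑ-Reasoning
  env = begin
    removeAt Θ i ⊎ₑ Δ                                 ≈⟨ ⊎ₑ-cong (removeAt-cong i θ) g ⟩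
    removeAt (Γ₁ ⊎ₑ Γ₂) i ⊎ₑ (Δ₁ ⊎ₑ Δ₂)               ≡⟨ cong (_⊎ₑ (Δ₁ ⊎ₑ Δ₂)) (removeAt-⊎ₑ Γ₁ Γ₂ i) ⟩
    (removeAt Γ₁ i ⊎ₑ removeAt Γ₂ i) ⊎ₑ (Δ₁ ⊎ₑ Δ₂)    ≈⟨ ⊎ₑ-Properties.interchange _ _ Δ₁ Δ₂ ⟩
    (removeAt Γ₁ i ⊎ₑ Δ₁) ⊎ₑ (removeAt Γ₂ i ⊎ₑ Δ₂)    ∎
Premises-subst {Δ = Δ} i isV [] Dv with value-𝟘⇒∅ isV (proj₁ (cast refl (lookup-replicate i 𝟘) Dv))
... | refl = ∅ , [] , ≈ₑ-sym (≡⇒≈ₑ (trans (⊎ₑ-identityʳ _) (removeAt-∅ i))) , z≤n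
Premises-subst {Δ = Δ} i isV (_∷_ {Γ = Γd@(_ ∷ _)} {Δ = Γr} {P = P} d ps) Dv
  with cast refl (lookup-zipWith _⊎ₚ_ i Γd Γr) Dv
... | Dv' , eq₀ with value-split (lookup Γd i) (lookup Γr i) isV Dv'
... | Δ₁ , Δ₂ , D₁ , D₂ , g , eq with ⊢-weaken zero D₁
... | D₁' , eq₁ with ⊢-subst (suc i) (rename-Value suc isV) d D₁' | Premises-subst i isV ps D₂
... | d' , le₁ | Γ' , ps' , g' , le₂ with convertEnv (≡⇒≈ (⊎ₚ-identityʳ P) ∷ ≈ₑ-refl _) d'
... | d'' , eq₂ = (removeAt Γd i ⊎ₑ Δ₁) ⊎ₑ Γ' , d'' ∷ ps' , env ,
  ℕ.≤-trans (ℕ.+-mono-≤ (ℕ.≤-trans (ℕ.≤-reflexive eq₂) (ℕ.≤-trans le₁ (ℕ.≤-reflexive (cong (#app d +_) eq₁)))) le₂)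
    (ℕ.≤-reflexive (trans (ℕ+.interchange (#app d) (#app D₁) (#appᴾ ps) (#app D₂))
      (cong ((#app d + #appᴾ ps) +_) (trans eq eq₀))))
  where
  open ≈ₑ-Reasoning
  env = begin
    (removeAt Γd i ⊎ₑ Δ₁) ⊎ₑ Γ'                        ≈⟨ ⊎ₑ-cong (≈ₑ-refl _) g' ⟩
    (removeAt Γd i ⊎ₑ Δ₁) ⊎ₑ (removeAt Γr i ⊎ₑ Δ₂)     ≈⟨ ⊎ₑ-Properties.interchange _ Δ₁ _ Δ₂ ⟩
    (removeAt Γd i ⊎ₑ removeAt Γr i) ⊎ₑ (Δ₁ ⊎ₑ Δ₂)     ≡⟨ cong (_⊎ₑ (Δ₁ ⊎ₑ Δ₂)) (sym (removeAt-⊎ₑ Γd Γr i)) ⟩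
    removeAt (Γd ⊎ₑ Γr) i ⊎ₑ (Δ₁ ⊎ₑ Δ₂)                ≈⟨ ⊎ₑ-cong (≈ₑ-refl _) (≈ₑ-sym g) ⟩
    removeAt (Γd ⊎ₑ Γr) i ⊎ₑ Δ                         ∎

⊢-subst⁻¹ : ∀ {n} {Γ : Env n} {Q} {v : Term n} (i : Fin (suc n)) (t : Term (suc n)) → Value v →
  Γ ⊢ subst (substAt i v) t ∶ Q →
  Σ[ Θ ∈ Env (suc n) ] Σ[ Δ ∈ Env n ] Θ ⊢ t ∶ Q × Δ ⊢ v ∶ lookup Θ i × Γ ≈ₑ (removeAt Θ i ⊎ₑ Δ)
Premises-subst⁻¹ : ∀ {n} {Γ : Env n} {ps} {v : Term n} (i : Fin (suc n)) (s : Term (suc (suc n))) →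
  Value v → Premises (subst (substAt (suc i) (weaken v)) s) Γ ps →
  Σ[ Θ ∈ Env (suc n) ] Σ[ Δ ∈ Env n ] Premises s Θ ps × Δ ⊢ v ∶ lookup Θ i × Γ ≈ₑ (removeAt Θ i ⊎ₑ Δ)
⊢-subst⁻¹ {Γ = Γ} {Q} {v} i (var x) isV D with punchIn-view i x
... | hole = i ↦ₑ Q , Γ , ax (≈ₑ-refl _) ,
  proj₁ (cast (substAt-self i v) (sym (lookup∘update i ∅ Q)) D) ,
  ≡⇒≈ₑ (sym (trans (cong (_⊎ₑ Γ) (removeAt-↦ₑ i Q)) (⊎ₑ-identityˡ Γ)))
... | punched k with proj₁ (cast (substAt-punchIn i v k) refl D)
... | ax e = punchIn i k ↦ₑ Q , ∅ , ax (≈ₑ-refl _) ,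
  proj₁ (cast refl (sym (lookup-↦ₑ-punchIn i k Q)) (proj₁ (value-𝟘 isV))) ,
  ≈ₑ-trans e (≡⇒≈ₑ (sym (trans (⊎ₑ-identityʳ _) (removeAt-↦ₑ-punchIn i k Q))))
⊢-subst⁻¹ {v = v} i (lam s) isV (lam ps e r)
  with Premises-subst⁻¹ i s isV (proj₁ (castᴾ (subst-cong (exts-substAt i v) s) ps))
... | Θ , Δ , ps' , Dv , g = Θ , Δ , lam ps' (≈ₑ-refl _) r , Dv , ≈ₑ-trans e g
⊢-subst⁻¹ i (app t u) isV (app d e θ) with ⊢-subst⁻¹ i t isV d | ⊢-subst⁻¹ i u isV e
... | Θ₁ , Δ₁ , d' , D₁ , g₁ | Θ₂ , Δ₂ , e' , D₂ , g₂ =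
  Θ₁ ⊎ₑ Θ₂ , Δ₁ ⊎ₑ Δ₂ , app d' e' (≈ₑ-refl _) ,
  proj₁ (cast refl (sym (lookup-zipWith _⊎ₚ_ i Θ₁ Θ₂)) (value-merge isV D₁ D₂)) , env
  where
  open ≈ₑ-Reasoning
  env = begin
    _                                                   ≈⟨ θ ⟩
    _ ⊎ₑ _                                              ≈⟨ ⊎ₑ-cong g₁ g₂ ⟩
    (removeAt Θ₁ i ⊎ₑ Δ₁) ⊎ₑ (removeAt Θ₂ i ⊎ₑ Δ₂)      ≈⟨ ⊎ₑ-Properties.interchange _ Δ₁ _ Δ₂ ⟩
    (removeAt Θ₁ i ⊎ₑ removeAt Θ₂ i) ⊎ₑ (Δ₁ ⊎ₑ Δ₂)      ≡⟨ cong (_⊎ₑ (Δ₁ ⊎ₑ Δ₂)) (sym (removeAt-⊎ₑ Θ₁ Θ₂ i)) ⟩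
    removeAt (Θ₁ ⊎ₑ Θ₂) i ⊎ₑ (Δ₁ ⊎ₑ Δ₂)                 ∎
Premises-subst⁻¹ i s isV [] =
  ∅ , ∅ , [] , proj₁ (cast refl (sym (lookup-replicate i 𝟘)) (proj₁ (value-𝟘 isV))) ,
  ≡⇒≈ₑ (sym (trans (⊎ₑ-identityʳ _) (removeAt-∅ i)))
Premises-subst⁻¹ {v = v} i s isV (_∷_ {Γ = Γd} {P = P} d ps) with ⊢-subst⁻¹ (suc i) s (rename-Value suc isV) d
... | P' ∷ Θd@(_ ∷ _) , Δd , d' , Dv , g with ⊢-strengthen zero v Dv
... | Δd' , Dv' , h with ≈ₑ-trans g (⊎ₑ-cong (≈ₑ-refl (P' ∷ removeAt Θd i)) h)
... | p ∷ gs with convertEnv (≈-trans (≡⇒≈ (sym (⊎ₚ-identityʳ P'))) (≈-sym p) ∷ ≈ₑ-refl Θd) d'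
... | d'' , _ with Premises-subst⁻¹ i s isV ps
... | Θr , Δr , ps' , Dvr , gr =
  Θd ⊎ₑ Θr , Δd' ⊎ₑ Δr , d'' ∷ ps' ,
  proj₁ (cast refl (sym (lookup-zipWith _⊎ₚ_ i Θd Θr)) (value-merge isV Dv' Dvr)) , env
  where
  open ≈ₑ-Reasoning
  env = begin
    Γd ⊎ₑ _                                              ≈⟨ ⊎ₑ-cong gs gr ⟩
    (removeAt Θd i ⊎ₑ Δd') ⊎ₑ (removeAt Θr i ⊎ₑ Δr)      ≈⟨ ⊎ₑ-Properties.interchange _ Δd' _ Δr ⟩
    (removeAt Θd i ⊎ₑ removeAt Θr i) ⊎ₑ (Δd' ⊎ₑ Δr)      ≡⟨ cong (_⊎ₑ (Δd' ⊎ₑ Δr)) (sym (removeAt-⊎ₑ Θd Θr i)) ⟩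
    removeAt (Θd ⊎ₑ Θr) i ⊎ₑ (Δd' ⊎ₑ Δr)                 ∎

subject-expansion : ∀ {n} {Γ : Env n} {t t' : Term n} {Q} → t ▷shuf t' → Γ ⊢ t' ∶ Q → Γ ⊢ t ∶ Q
subject-expansion (root (βv (βv t v isV))) D
  with ⊢-subst⁻¹ zero t isV (proj₁ (cast (subst-cong (single≗substAt₀ v) t) refl D))
... | P ∷ Θ , Δ , d , Dv , g = app (proj₁ (lam-intro d)) Dv g
subject-expansion (root (σ1 (σ1 t u s))) (app {Γ = Γa} {Δ = Γu} Dλ Du θ) with lam-inversion Dλ
... | _ , app {Γ = P ∷ Ξ₁} {Δ = Ξ₂} dt dws θ' , ga , _ with ⊢-strengthen zero s dws
... | Ξ₂' , ds , h with ≈ₑ-trans θ' (⊎ₑ-cong (≈ₑ-refl (P ∷ Ξ₁)) h)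
... | p ∷ gs with convertEnv (≈-trans (≡⇒≈ (sym (⊎ₚ-identityʳ P))) (≈-sym p) ∷ ≈ₑ-refl Ξ₁) dt
... | dt' , _ = app (app (proj₁ (lam-intro dt')) Du (≈ₑ-refl _)) ds
  (≈ₑ-trans θ (≈ₑ-trans (⊎ₑ-cong (≈ₑ-trans ga gs) (≈ₑ-refl Γu)) (⊎ₑ-Properties.xy∙z≈xz∙y Ξ₁ Ξ₂' Γu)))
subject-expansion (root (σ3 (σ3 v s u isV))) (app {Γ = Γa} {Δ = Γu} Dλ Du θ) with lam-inversion Dλ
... | _ , app {Γ = Ξ₁} {Δ = U ∷ Ξ₂} dwv ds θ' , ga , _ with ⊢-strengthen zero v dwv
... | Ξ₁' , dv , h with ≈ₑ-trans θ' (⊎ₑ-cong h (≈ₑ-refl (U ∷ Ξ₂)))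
... | p ∷ gs with convertEnv (≈-trans (≡⇒≈ (sym (⊎ₚ-identityˡ U))) (≈-sym p) ∷ ≈ₑ-refl Ξ₂) ds
... | ds' , _ = app dv (app (proj₁ (lam-intro ds')) Du (≈ₑ-refl _))
  (≈ₑ-trans θ (≈ₑ-trans (⊎ₑ-cong (≈ₑ-trans ga gs) (≈ₑ-refl Γu)) (≡⇒≈ₑ (⊎ₑ-assoc Ξ₁' Ξ₂ Γu))))
subject-expansion (redex u st) (app Dλ Du θ) with lam-inversion Dλ
... | _ , d , ga , _ =
  app (proj₁ (lam-intro (subject-expansion st d))) Du (≈ₑ-trans θ (⊎ₑ-cong ga (≈ₑ-refl _)))
subject-expansion (appL u st) (app d e θ) = app (subject-expansion st d) e θ
subject-expansion (appR t st) (app d e θ) = app d (subject-expansion st e) θ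

subject-expansion* : ∀ {n} {Γ : Env n} {t u : Term n} {Q} → t ▷shuf* u → Γ ⊢ u ∶ Q → Γ ⊢ t ∶ Q
subject-expansion* ε         D = D
subject-expansion* (st ◅ sts) D = subject-expansion st (subject-expansion* sts D)

-- σ-steps keep the size of a derivation, but decrease this weight.
weight : ∀ {n} → Term n → ℕ
weight (var x)   = 2
weight (lam t)   = suc (weight t)
weight (app t u) = weight t * weight u

2≤weight : ∀ {n} (t : Term n) → 2 ≤ weight t
2≤weight (var x)   = ℕ.≤-refl
2≤weight (lam t)   = ℕ.m≤n⇒m≤1+n (2≤weight t)
2≤weight (app t u) = ℕ.*-mono-≤ (2≤weight t) (ℕ.≤-trans (s≤s z≤n) (2≤weight u))

weight-nonZero : ∀ {n} (t : Term n) → NonZero (weight t)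
weight-nonZero t = >-nonZero (ℕ.<-≤-trans (s≤s z≤n) (2≤weight t))

weight-rename : ∀ {m n} (ρ : Fin m → Fin n) t → weight (rename ρ t) ≡ weight t
weight-rename ρ (var x)   = refl
weight-rename ρ (lam t)   = cong suc (weight-rename (ext ρ) t)
weight-rename ρ (app t u) = cong₂ _*_ (weight-rename ρ t) (weight-rename ρ u)

1+m*n<o+m*n : ∀ m n o → 2 ≤ o → .{{NonZero n}} → suc m * n < (o + m) * n
1+m*n<o+m*n m n o 2≤o = ℕ.*-monoˡ-< n (ℕ.+-monoˡ-< m 2≤o)

weight-σ1 : ∀ {n} (t : Term (suc n)) (u s : Term n) →
  weight (app (lam (app t (weaken s))) u) < weight (app (app (lam t) u) s)
weight-σ1 t u s rewrite weight-rename suc s =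
  ℕ.<-≤-trans (1+m*n<o+m*n (weight t * weight s) (weight u) (weight s) (2≤weight s) {{weight-nonZero u}})
    (ℕ.≤-reflexive (rearrange (weight t) (weight u) (weight s)))
  where
  rearrange : ∀ t u s → (s + t * s) * u ≡ (suc t * u) * s
  rearrange = solve-∀

weight-σ3 : ∀ {n} (v : Term n) (s : Term (suc n)) (u : Term n) →
  weight (app (lam (app (weaken v) s)) u) < weight (app v (app (lam s) u))
weight-σ3 v s u rewrite weight-rename suc v =
  ℕ.<-≤-trans (1+m*n<o+m*n (weight v * weight s) (weight u) (weight v) (2≤weight v) {{weight-nonZero u}})
    (ℕ.≤-reflexive (rearrange (weight v) (weight s) (weight u)))
  where
  rearrange : ∀ v s u → (v + v * s) * u ≡ v * (suc s * u)
  rearrange = solve-∀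

_<ₗₑₓ_ : ℕ × ℕ → ℕ × ℕ → Set
_<ₗₑₓ_ = ×-Lex _≡_ _<_ _<_

<ₗₑₓ-wellFounded : WellFounded _<ₗₑₓ_
<ₗₑₓ-wellFounded = ×-wellFounded <-wellFounded <-wellFounded

<ₗₑₓ-map : {f g : ℕ → ℕ} → (∀ {x y} → x < y → f x < f y) → (∀ {x y} → x < y → g x < g y) →
  ∀ {a b a' b'} → (a' , b') <ₗₑₓ (a , b) → (f a' , g b') <ₗₑₓ (f a , g b)
<ₗₑₓ-map f-mono g-mono (inj₁ a'<a)         = inj₁ (f-mono a'<a)
<ₗₑₓ-map f-mono g-mono (inj₂ (refl , b'<b)) = inj₂ (refl , g-mono b'<b)

measure : ∀ {n} {Γ : Env n} {t Q} → Γ ⊢ t ∶ Q → ℕ × ℕ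
measure {t = t} D = #app D , weight t

subject-reduction : ∀ {n} {Γ : Env n} {t t' : Term n} {Q} → t ▷shuf t' → (D : Γ ⊢ t ∶ Q) →
  Σ[ D' ∈ Γ ⊢ t' ∶ Q ] measure D' <ₗₑₓ measure D
subject-reduction (root (βv (βv t v isV))) (app {Δ = Δ} Dλ Dv θ) with lam-inversion Dλ
... | _ , d , g , eq with ⊢-subst zero isV d Dv
... | D₁ , le with cast (sym (subst-cong (single≗substAt₀ v) t)) refl D₁
... | D₂ , eq' with convertEnv (≈ₑ-sym (≈ₑ-trans θ (⊎ₑ-cong g (≈ₑ-refl Δ)))) D₂
... | D₃ , eq'' = D₃ , inj₁ (s≤s (ℕ.≤-trans (ℕ.≤-reflexive (trans eq'' eq'))
                                   (ℕ.≤-trans le (ℕ.≤-reflexive (cong (_+ #app Dv) eq)))))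
subject-reduction (root (σ1 (σ1 t u s))) (app {Δ = Γs} (app {Δ = Γu} Dλ Du θ') Ds θ) with lam-inversion Dλ
... | Γ' , d , g , eq₁ with ⊢-weaken zero Ds
... | Dws , eq₂ with lam-intro (app d Dws (≡⇒≈ (sym (⊎ₚ-identityʳ _)) ∷ ≈ₑ-refl (Γ' ⊎ₑ Γs)))
... | Dl , eq₃ = app Dl Du env , inj₂ (#app-eq , weight-σ1 t u s)
  where
  env = ≈ₑ-trans θ (≈ₑ-trans (⊎ₑ-cong (≈ₑ-trans θ' (⊎ₑ-cong g (≈ₑ-refl Γu))) (≈ₑ-refl Γs))
          (⊎ₑ-Properties.xy∙z≈xz∙y Γ' Γu Γs))
  #app-eq : suc (#app Dl + #app Du) ≡ suc (suc (#app Dλ + #app Du) + #app Ds)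
  #app-eq = cong suc (trans (cong (_+ #app Du) (trans eq₃ (cong suc (cong₂ _+_ eq₁ eq₂))))
                       (cong suc (ℕ+.xy∙z≈xz∙y (#app Dλ) (#app Ds) (#app Du))))
subject-reduction (root (σ3 (σ3 v s u isV))) (app {Γ = Γv} Dv (app {Δ = Γu} Dλ Du θ') θ) with lam-inversion Dλ
... | Γ' , d , g , eq₁ with ⊢-weaken zero Dv
... | Dwv , eq₂ with lam-intro (app Dwv d (≡⇒≈ (sym (⊎ₚ-identityˡ _)) ∷ ≈ₑ-refl (Γv ⊎ₑ Γ')))
... | Dl , eq₃ = app Dl Du env , inj₂ (#app-eq , weight-σ3 v s u)
  where
  env = ≈ₑ-trans θ (≈ₑ-trans (⊎ₑ-cong (≈ₑ-refl Γv) (≈ₑ-trans θ' (⊎ₑ-cong g (≈ₑ-refl Γu))))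
          (≡⇒≈ₑ (sym (⊎ₑ-assoc Γv Γ' Γu))))
  #app-eq : suc (#app Dl + #app Du) ≡ suc (#app Dv + suc (#app Dλ + #app Du))
  #app-eq = cong suc (trans (cong (_+ #app Du) (trans eq₃ (cong suc (cong₂ _+_ eq₂ eq₁))))
                       (trans (cong suc (ℕ.+-assoc (#app Dv) (#app Dλ) (#app Du)))
                         (sym (ℕ.+-suc (#app Dv) (#app Dλ + #app Du)))))
subject-reduction (redex u st) (app {Δ = Δ} Dλ Du θ) with lam-inversion Dλ
... | _ , d , g , eq₁ with subject-reduction st d
... | d' , d'<d with lam-intro d'
... | Dl , eq₂ = app Dl Du (≈ₑ-trans θ (⊎ₑ-cong g (≈ₑ-refl Δ))) ,
  <ₗₑₓ-map (λ lt → s≤s (ℕ.+-monoˡ-< (#app Du) lt)) (λ lt → ℕ.*-monoˡ-< (weight u) {{weight-nonZero u}} (s≤s lt))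
    (subst₂ (λ a b → (a , _) <ₗₑₓ (b , _)) (sym eq₂) eq₁ d'<d)
subject-reduction (appL u st) (app d e θ) with subject-reduction st d
... | d' , d'<d = app d' e θ ,
  <ₗₑₓ-map (λ lt → s≤s (ℕ.+-monoˡ-< (#app e) lt)) (ℕ.*-monoˡ-< (weight u) {{weight-nonZero u}}) d'<d
subject-reduction (appR t st) (app d e θ) with subject-reduction st e
... | e' , e'<e = app d e' θ ,
  <ₗₑₓ-map (λ lt → s≤s (ℕ.+-monoʳ-< (#app d) lt)) (ℕ.*-monoʳ-< (weight t) {{weight-nonZero t}}) e'<e

var-normal : ∀ {n} (x : Fin n) → ShufNormal (var x)
var-normal x t' (root (βv ()))
var-normal x t' (root (σ1 ()))
var-normal x t' (root (σ3 ()))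

lam-normal : ∀ {n} (s : Term (suc n)) → ShufNormal (lam s)
lam-normal s t' (root (βv ()))
lam-normal s t' (root (σ1 ()))
lam-normal s t' (root (σ3 ()))

-- Balanced contexts reduce under a λ only when it is applied.
LamBodyNormal : ∀ {n} → Term n → Set
LamBodyNormal (lam s) = ShufNormal s
LamBodyNormal _       = ⊤

app-normal : ∀ {n} {a b : Term n} → ShufNormal a → ShufNormal b → LamBodyNormal a →
  (∀ {t'} → ¬ RootShuf (app a b) t') → ShufNormal (app a b)
app-normal a-nf b-nf body-nf no-root t' (root r)     = no-root r
app-normal a-nf b-nf body-nf no-root t' (redex u st) = body-nf _ st
app-normal a-nf b-nf body-nf no-root t' (appL u st)  = a-nf _ st
app-normal a-nf b-nf body-nf no-root t' (appR t st)  = b-nf _ st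

Reducible : ∀ {n} → Term n → Set
Reducible {n} t = ∃[ t' ] t ▷shuf t'

progress : ∀ {n} (t : Term n) → Reducible t ⊎ ShufNormal t
progress-app : ∀ {n} (a b : Term n) → ShufNormal a → ShufNormal b → Reducible (app a b) ⊎ ShufNormal (app a b)
progress-βv : ∀ {n} (s : Term (suc n)) (b : Term n) → ShufNormal s → ShufNormal b →
  Reducible (app (lam s) b) ⊎ ShufNormal (app (lam s) b)
progress (var x) = inj₂ (var-normal x)
progress (lam t) = inj₂ (lam-normal t)
progress (app a b) with progress a | progress b
... | inj₁ (_ , st) | _             = inj₁ (_ , appL b st)
... | inj₂ _        | inj₁ (_ , st) = inj₁ (_ , appR a st)
... | inj₂ a-nf     | inj₂ b-nf     = progress-app a b a-nf b-nf
progress-app (lam s) b a-nf b-nf with progress s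
... | inj₁ (_ , st) = inj₁ (_ , redex b st)
... | inj₂ s-nf     = progress-βv s b s-nf b-nf
progress-app (var x) (app (lam r) u) a-nf b-nf = inj₁ (_ , root (σ3 (σ3 (var x) r u (var x))))
progress-app (var x) (var y) a-nf b-nf = inj₂ (app-normal a-nf b-nf tt λ { (βv ()) ; (σ1 ()) ; (σ3 ()) })
progress-app (var x) (lam r) a-nf b-nf = inj₂ (app-normal a-nf b-nf tt λ { (βv ()) ; (σ1 ()) ; (σ3 ()) })
progress-app (var x) (app (var y) u) a-nf b-nf = inj₂ (app-normal a-nf b-nf tt λ { (βv ()) ; (σ1 ()) ; (σ3 ()) })
progress-app (var x) (app (app c d) u) a-nf b-nf = inj₂ (app-normal a-nf b-nf tt λ { (βv ()) ; (σ1 ()) ; (σ3 ()) })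
progress-app (app (lam s) u) b a-nf b-nf = inj₁ (_ , root (σ1 (σ1 s u b)))
progress-app (app (var y) c) b a-nf b-nf = inj₂ (app-normal a-nf b-nf tt λ { (βv ()) ; (σ1 ()) ; (σ3 (σ3 _ _ _ ())) })
progress-app (app (app c d) e) b a-nf b-nf = inj₂ (app-normal a-nf b-nf tt λ { (βv ()) ; (σ1 ()) ; (σ3 (σ3 _ _ _ ())) })
progress-βv s (var y) s-nf b-nf = inj₁ (_ , root (βv (βv s (var y) (var y))))
progress-βv s (lam r) s-nf b-nf = inj₁ (_ , root (βv (βv s (lam r) (lam r))))
progress-βv s (app (lam r) u) s-nf b-nf = inj₁ (_ , root (σ3 (σ3 (lam s) r u (lam s))))
progress-βv s (app (var y) u) s-nf b-nf =
  inj₂ (app-normal (lam-normal s) b-nf s-nf λ { (βv (βv _ _ ())) ; (σ1 ()) ; (σ3 ()) })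
progress-βv s (app (app c d) u) s-nf b-nf =
  inj₂ (app-normal (lam-normal s) b-nf s-nf λ { (βv (βv _ _ ())) ; (σ1 ()) ; (σ3 ()) })

normal-∅⇒Value : ∀ {n} {t : Term n} {Q} → ShufNormal t → ∅ ⊢ t ∶ Q → Value t
normal-∅⇒Value {t = var x} t-nf D = var x
normal-∅⇒Value {t = lam s} t-nf D = lam s
normal-∅⇒Value {t = app a b} t-nf (app {Γ = Γ₁} {Δ = Γ₂} d e θ) with ⊎ₑ≡∅⇒ Γ₁ Γ₂ (≈ₑ∅⇒≡∅ (≈ₑ-sym θ))
... | refl , refl with normal-∅⇒Value (λ t' st → t-nf _ (appL b st)) d
                     | normal-∅⇒Value (λ t' st → t-nf _ (appR a st)) e
... | lam s | b-val = ⊥-elim (t-nf _ (root (βv (βv s b b-val))))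
... | var x | _ with d
... | ax {P = P} e' with 𝟘≈⇒≡𝟘 (≈-trans (≡⇒≈ (sym (lookup-replicate x 𝟘)))
                                 (≈-trans (Pointwise.lookup e' x) (≡⇒≈ (lookup∘update x ∅ P))))
... | ()

normalize : ∀ {n} {Γ : Env n} {t Q} (D : Γ ⊢ t ∶ Q) → Acc _<ₗₑₓ_ (measure D) →
  Σ[ u ∈ Term n ] t ▷shuf* u × ShufNormal u × Γ ⊢ u ∶ Q
normalize {t = t} D (acc rs) with progress t
... | inj₂ t-nf = t , ε , t-nf , D
... | inj₁ (t' , st) with subject-reduction st D
... | D' , D'<D with normalize D' (rs D'<D)
... | u , sts , u-nf , Du = u , st ◅ sts , u-nf , Du

NormalizesToValue⇒⊢𝟘 : ∀ {n} {t : Term n} → NormalizesToValue t → ∅ ⊢ t ∶ 𝟘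
NormalizesToValue⇒⊢𝟘 (u , sts , _ , u-val) = subject-expansion* sts (proj₁ (value-𝟘 u-val))

⊢-∅⇒NormalizesToValue : ∀ {n} {t : Term n} {Q} → ∅ ⊢ t ∶ Q → NormalizesToValue t
⊢-∅⇒NormalizesToValue D with normalize D (<ₗₑₓ-wellFounded _)
... | u , sts , u-nf , Du = u , sts , u-nf , normal-∅⇒Value u-nf Du

mainTheorem4 : (k : ℕ) (t : Term k) →
    (NormalizesToValue t ⇔ ⟦ t ⟧ (replicate k 𝟘 , 𝟘))
    × (⟦ t ⟧ (replicate k 𝟘 , 𝟘) ⇔ (∅ ⊢ t ∶ 𝟘))
mainTheorem4 k t = mk⇔ NormalizesToValue⇒⊢𝟘 ⊢-∅⇒NormalizesToValue , mk⇔ id id
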